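{- Let $N=(E,\mathcal L(N))$ and $M=(E,\mathcal L(M))$ be matroids on the same finite ground set $E$ with $\mathcal L(M)\subseteq\mathcal L(N)$. Then $N\ominus M=(N^*\vee M)^*$.
   Context: For matroids $N,M$ on a common ground set with $\mathcal L(M)\subseteq\mathcal L(N)$, define $N\ominus M=(E,\mathcal L(N\ominus M))$ where $\mathcal L(N\ominus M)=\{S:\text{there exist a base }B_N\text{ of }N\text{ and a base }B_M\text{ of }M\text{ with }B_N\supseteq B_M\text{ and }S\subseteq B_N\setminus B_M\}$; bases are maximal independent sets. The dual of a matroid $N$ is $N^*=(E,\{S\subseteq E: S\subseteq E\setminus B\text{ for some base }B\text{ of }N\})$. The union is $N\vee M=(E,\{S\cup T: S\in\mathcal L(N),T\in\mathcal L(M)\})$. -}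

module Defs where

open import Data.Nat using (ℕ; _<_)
open import Data.Fin using (Fin)
open import Data.Fin.Subset using (Subset; ⊥; ⁅_⁆; _∈_; _∉_; _⊆_; _∪_; _─_; ∁; ∣_∣)
open import Data.Product using (Σ; ∃; ∃-syntax; _×_)
open import Relation.Binary.PropositionalEquality using (_≡_)

SetSystem : ℕ → Set₁
SetSystem n = Subset n → Set

record IsMatroid {n : ℕ} (𝓛 : SetSystem n) : Set where
  field
    empty-indep : 𝓛 ⊥
    hereditary  : ∀ {I J} → 𝓛 J → I ⊆ J → 𝓛 I
    augment     : ∀ {I J} → 𝓛 I → 𝓛 J → ∣ I ∣ < ∣ J ∣ →
                  ∃[ x ] (x ∈ J × x ∉ I × 𝓛 (I ∪ ⁅ x ⁆))

IsBase : ∀ {n} → SetSystem n → Subset n → Set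
IsBase 𝓛 B = 𝓛 B × (∀ S → 𝓛 S → B ⊆ S → S ⊆ B)

dual : ∀ {n} → SetSystem n → SetSystem n
dual 𝓛 S = ∃[ B ] (IsBase 𝓛 B × S ⊆ ∁ B)

union : ∀ {n} → SetSystem n → SetSystem n → SetSystem n
union 𝓝 𝓜 X = ∃[ S ] ∃[ T ] (𝓝 S × 𝓜 T × X ≡ S ∪ T)

minus : ∀ {n} → SetSystem n → SetSystem n → SetSystem n
minus 𝓝 𝓜 S = ∃[ BN ] ∃[ BM ] (IsBase 𝓝 BN × IsBase 𝓜 BM × BM ⊆ BN × S ⊆ BN ─ BM)

module Submission where

-- Write 𝓤 = 𝓛(N* ∨ M); its members are the sets A ∪ T with A inside the
-- complement ∁B of a base B of N and T ∈ 𝓛(M).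
-- (⇒) For bases B_M ⊆ B_N, the set ∁B_N ∪ B_M has the largest possible
--     size |∁B_N| + |B_M| in 𝓤 (bases of a matroid are equicardinal), so
--     it is a base of 𝓤, with complement B_N ─ B_M.
-- (⇐) A base X = A ∪ T of 𝓤 equals ∁B ∪ (T ∩ B), so we may assume T ⊆ B.
--     Then T is a base of M: if T ∪ {x} ∈ 𝓛(M), extend it to a base B″ of
--     N inside T ∪ {x} ∪ B; maximality of X against ∁B″ ∪ T ∪ {x} forces
--     B ⊆ B″, hence B = B″ and x ∈ T.  The complement of X is B ─ T.

open import Defs
open import Data.Nat using (ℕ; zero; suc; _+_; _∸_; _≤_; s≤s; _<?_)
open import Data.Nat.Properties
  using (≤-refl; ≤-trans; ≤-reflexive; ≤-antisym; <⇒≱; ≮⇒≥; n≤1+n;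
         +-suc; +-mono-≤; +-monoʳ-≤; m≤m+n; ≤-<-trans; module ≤-Reasoning)
open import Data.Fin using (Fin)
open import Data.Fin.Subset
  using (Subset; ⁅_⁆; _∈_; _∉_; _⊆_; _⊂_; _∪_; _∩_; _─_; ∁; ∣_∣; inside; outside)
open import Data.Fin.Subset.Properties
  using (_∈?_; x∈⁅x⁆; x∈⁅y⁆⇒x≡y; p⊆p∪q; q⊆p∪q; x∈p∪q⁻; p∩q⊆p; p∩q⊆q; x∈p∩q⁺;
         x∈∁p⇒x∉p; x∉p⇒x∈∁p; x∉∁p⇒x∈p; p⊆q⇒∁p⊇∁q; ∣∁p∣≡n∸∣p∣;
         p⊆q⇒∣p∣≤∣q∣; p⊂q⇒∣p∣<∣q∣)
open import Data.Product using (∃-syntax; _×_; _,_; proj₁; proj₂)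
open import Data.Sum using (_⊎_; inj₁; inj₂; [_,_])
open import Data.Vec using ([]; _∷_; here; there)
open import Function using (id)
open import Function.Bundles using (_⇔_; mk⇔)
open import Relation.Nullary using (yes; no; contradiction)
open import Relation.Binary.PropositionalEquality using (_≡_; refl; sym; trans; cong; subst; module ≡-Reasoning)

∈∪⁅⁆⁻ : ∀ {n} {x y : Fin n} (I : Subset n) → x ∈ I ∪ ⁅ y ⁆ → x ∈ I ⊎ x ≡ y
∈∪⁅⁆⁻ {y = y} I x∈ with x∈p∪q⁻ I ⁅ y ⁆ x∈
... | inj₁ x∈I  = inj₁ x∈I
... | inj₂ x∈⁅y⁆ = inj₂ (x∈⁅y⁆⇒x≡y y x∈⁅y⁆)

∪⁅⁆⊆ : ∀ {n} {I J : Subset n} {y : Fin n} → I ⊆ J → y ∈ J → I ∪ ⁅ y ⁆ ⊆ J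
∪⁅⁆⊆ {I = I} I⊆J y∈J x∈ with ∈∪⁅⁆⁻ I x∈
... | inj₁ x∈I = I⊆J x∈I
... | inj₂ refl = y∈J

⊂∪⁅⁆ : ∀ {n} {I : Subset n} {x : Fin n} → x ∉ I → I ⊂ I ∪ ⁅ x ⁆
⊂∪⁅⁆ {I = I} {x} x∉I = p⊆p∪q ⁅ x ⁆ , x , q⊆p∪q I ⁅ x ⁆ (x∈⁅x⁆ x) , x∉I

∁[∁p∪q]≡p─q : ∀ {n} (p q : Subset n) → ∁ (∁ p ∪ q) ≡ p ─ q
∁[∁p∪q]≡p─q []            []            = refl
∁[∁p∪q]≡p─q (inside  ∷ p) (inside  ∷ q) = cong (outside ∷_) (∁[∁p∪q]≡p─q p q)
∁[∁p∪q]≡p─q (inside  ∷ p) (outside ∷ q) = cong (inside  ∷_) (∁[∁p∪q]≡p─q p q)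
∁[∁p∪q]≡p─q (outside ∷ p) (inside  ∷ q) = cong (outside ∷_) (∁[∁p∪q]≡p─q p q)
∁[∁p∪q]≡p─q (outside ∷ p) (outside ∷ q) = cong (outside ∷_) (∁[∁p∪q]≡p─q p q)

∣p∪q∣≤∣p∣+∣q∣ : ∀ {n} (p q : Subset n) → ∣ p ∪ q ∣ ≤ ∣ p ∣ + ∣ q ∣
∣p∪q∣≤∣p∣+∣q∣ []            []            = ≤-refl
∣p∪q∣≤∣p∣+∣q∣ (inside  ∷ p) (inside  ∷ q) =
  s≤s (≤-trans (∣p∪q∣≤∣p∣+∣q∣ p q) (+-monoʳ-≤ ∣ p ∣ (n≤1+n ∣ q ∣)))
∣p∪q∣≤∣p∣+∣q∣ (inside  ∷ p) (outside ∷ q) = s≤s (∣p∪q∣≤∣p∣+∣q∣ p q)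
∣p∪q∣≤∣p∣+∣q∣ (outside ∷ p) (inside  ∷ q) =
  ≤-trans (s≤s (∣p∪q∣≤∣p∣+∣q∣ p q)) (≤-reflexive (sym (+-suc ∣ p ∣ ∣ q ∣)))
∣p∪q∣≤∣p∣+∣q∣ (outside ∷ p) (outside ∷ q) = ∣p∪q∣≤∣p∣+∣q∣ p q

∣p∪q∣≡∣p∣+∣q∣ : ∀ {n} (p q : Subset n) → (∀ {x} → x ∈ p → x ∉ q) →
                ∣ p ∪ q ∣ ≡ ∣ p ∣ + ∣ q ∣
∣p∪q∣≡∣p∣+∣q∣ []            []            disj = refl
∣p∪q∣≡∣p∣+∣q∣ (inside  ∷ p) (inside  ∷ q) disj = contradiction here (disj here)
∣p∪q∣≡∣p∣+∣q∣ (inside  ∷ p) (outside ∷ q) disj =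
  cong suc (∣p∪q∣≡∣p∣+∣q∣ p q (λ x∈p x∈q → disj (there x∈p) (there x∈q)))
∣p∪q∣≡∣p∣+∣q∣ (outside ∷ p) (inside  ∷ q) disj =
  trans
    (cong suc (∣p∪q∣≡∣p∣+∣q∣ p q (λ x∈p x∈q → disj (there x∈p) (there x∈q))))
    (sym (+-suc ∣ p ∣ ∣ q ∣))
∣p∪q∣≡∣p∣+∣q∣ (outside ∷ p) (outside ∷ q) disj =
  ∣p∪q∣≡∣p∣+∣q∣ p q (λ x∈p x∈q → disj (there x∈p) (there x∈q))

max-card⇒base : ∀ {n} {𝓛 : SetSystem n} {X : Subset n} →
                𝓛 X → (∀ Y → 𝓛 Y → ∣ Y ∣ ≤ ∣ X ∣) → IsBase 𝓛 X
max-card⇒base {𝓛 = 𝓛} {X = X} lX largest = lX , maximal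
  where
  maximal : ∀ Y → 𝓛 Y → X ⊆ Y → Y ⊆ X
  maximal Y lY X⊆Y {z} z∈Y with z ∈? X
  ... | yes z∈X = z∈X
  ... | no z∉X  = contradiction (largest Y lY) (<⇒≱ (p⊂q⇒∣p∣<∣q∣ (X⊆Y , z , z∈Y , z∉X)))

base⊆member⇒base : ∀ {n} {𝓛 : SetSystem n} {X Y : Subset n} →
                   IsBase 𝓛 X → 𝓛 Y → X ⊆ Y → IsBase 𝓛 Y
base⊆member⇒base (lX , maxX) lY X⊆Y =
  lY , λ Z lZ Y⊆Z z∈Z → X⊆Y (maxX Z lZ (λ x∈X → Y⊆Z (X⊆Y x∈X)) z∈Z)

base-by-single-extensions : ∀ {n} {𝓛 : SetSystem n} {I : Subset n} →
  (∀ {J K} → 𝓛 K → J ⊆ K → 𝓛 J) → 𝓛 I →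
  (∀ x → 𝓛 (I ∪ ⁅ x ⁆) → x ∈ I) → IsBase 𝓛 I
base-by-single-extensions hereditary lI absorb =
  lI , λ J lJ I⊆J {z} z∈J → absorb z (hereditary lJ (∪⁅⁆⊆ I⊆J z∈J))

module MatroidBases {n : ℕ} {𝓛 : SetSystem n} (m : IsMatroid 𝓛) where
  open IsMatroid m

  indep≤base : ∀ {B T} → IsBase 𝓛 B → 𝓛 T → ∣ T ∣ ≤ ∣ B ∣
  indep≤base {B} {T} (lB , maxB) lT with ∣ B ∣ <? ∣ T ∣
  ... | no ¬B<T = ≮⇒≥ ¬B<T
  ... | yes B<T with augment lB lT B<T
  ... | x , _ , x∉B , lBx =
    contradiction (maxB (B ∪ ⁅ x ⁆) lBx (p⊆p∪q ⁅ x ⁆) (q⊆p∪q B ⁅ x ⁆ (x∈⁅x⁆ x))) x∉B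

  -- All bases have the same size, hence so do their complements.
  cobases-equicardinal : ∀ {B B′} → IsBase 𝓛 B → IsBase 𝓛 B′ → ∣ ∁ B ∣ ≡ ∣ ∁ B′ ∣
  cobases-equicardinal {B} {B′} bB bB′ = begin
    ∣ ∁ B ∣     ≡⟨ ∣∁p∣≡n∸∣p∣ B ⟩
    n ∸ ∣ B ∣   ≡⟨ cong (n ∸_) (≤-antisym (indep≤base bB′ (proj₁ bB)) (indep≤base bB (proj₁ bB′))) ⟩
    n ∸ ∣ B′ ∣  ≡⟨ ∣∁p∣≡n∸∣p∣ B′ ⟨
    ∣ ∁ B′ ∣    ∎
    where open ≡-Reasoning

  large-indep⇒base : ∀ {B J} → IsBase 𝓛 B → 𝓛 J → ∣ B ∣ ≤ ∣ J ∣ → IsBase 𝓛 J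
  large-indep⇒base {B} {J} bB lJ B≤J = base-by-single-extensions hereditary lJ absorb
    where
    absorb : ∀ x → 𝓛 (J ∪ ⁅ x ⁆) → x ∈ J
    absorb x lJx with x ∈? J
    ... | yes x∈J = x∈J
    ... | no x∉J  =
      contradiction (indep≤base bB lJx) (<⇒≱ (≤-<-trans B≤J (p⊂q⇒∣p∣<∣q∣ (⊂∪⁅⁆ x∉J))))

  extend-to-base : ∀ {B I} → IsBase 𝓛 B → 𝓛 I →
                   ∃[ B″ ] (IsBase 𝓛 B″ × I ⊆ B″ × B″ ⊆ I ∪ B)
  extend-to-base {B} {I} bB lI = grow ∣ B ∣ I lI id (p⊆p∪q B) (m≤m+n ∣ B ∣ ∣ I ∣)
    where
    -- Invariant: I ⊆ J ⊆ I ∪ B; the fuel k bounds the number of steps left.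
    grow : ∀ k J → 𝓛 J → I ⊆ J → J ⊆ I ∪ B → ∣ B ∣ ≤ k + ∣ J ∣ →
           ∃[ B″ ] (IsBase 𝓛 B″ × I ⊆ B″ × B″ ⊆ I ∪ B)
    grow k J lJ I⊆J J⊆I∪B bound with ∣ J ∣ <? ∣ B ∣ | k
    ... | no J≮B | _ = J , large-indep⇒base bB lJ (≮⇒≥ J≮B) , I⊆J , J⊆I∪B
    ... | yes J<B | zero = contradiction bound (<⇒≱ J<B)
    ... | yes J<B | suc k′ with augment lJ (proj₁ bB) J<B
    ... | x , x∈B , x∉J , lJx =
      grow k′ (J ∪ ⁅ x ⁆) lJx (λ i∈I → p⊆p∪q ⁅ x ⁆ (I⊆J i∈I))
           (∪⁅⁆⊆ J⊆I∪B (q⊆p∪q I B x∈B)) bound′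
      where
      bound′ : ∣ B ∣ ≤ k′ + ∣ J ∪ ⁅ x ⁆ ∣
      bound′ = ≤-trans bound (≤-trans (≤-reflexive (sym (+-suc k′ ∣ J ∣)))
                                      (+-monoʳ-≤ k′ (p⊂q⇒∣p∣<∣q∣ (⊂∪⁅⁆ x∉J))))

module DualUnion {n : ℕ} {𝓝 𝓜 : SetSystem n} (mN : IsMatroid 𝓝) (mM : IsMatroid 𝓜) where
  open MatroidBases mN using (cobases-equicardinal; extend-to-base)
  open MatroidBases mM using (indep≤base)

  𝓤 : SetSystem n
  𝓤 = union (dual 𝓝) 𝓜

  cobase∪indep∈𝓤 : ∀ {B T} → IsBase 𝓝 B → 𝓜 T → 𝓤 (∁ B ∪ T)
  cobase∪indep∈𝓤 {B} {T} bB lT = ∁ B , T , (B , bB , id) , lT , refl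

  𝓤-size-bound : ∀ {B BM Y} → IsBase 𝓝 B → IsBase 𝓜 BM → 𝓤 Y → ∣ Y ∣ ≤ ∣ ∁ B ∣ + ∣ BM ∣
  𝓤-size-bound {B} {BM} bB bM (A , T , (B′ , bB′ , A⊆∁B′) , lT , refl) = begin
    ∣ A ∪ T ∣            ≤⟨ ∣p∪q∣≤∣p∣+∣q∣ A T ⟩
    ∣ A ∣ + ∣ T ∣        ≤⟨ +-mono-≤ (p⊆q⇒∣p∣≤∣q∣ A⊆∁B′) (indep≤base bM lT) ⟩
    ∣ ∁ B′ ∣ + ∣ BM ∣    ≡⟨ cong (_+ ∣ BM ∣) (cobases-equicardinal bB′ bB) ⟩
    ∣ ∁ B ∣ + ∣ BM ∣     ∎
    where open ≤-Reasoning

  -- For bases B_M ⊆ B_N, the set ∁B_N ∪ B_M attains this bound, so it is a base of 𝓤.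
  cobase∪base-isBase : ∀ {BN BM} → IsBase 𝓝 BN → IsBase 𝓜 BM → BM ⊆ BN →
                       IsBase 𝓤 (∁ BN ∪ BM)
  cobase∪base-isBase {BN} {BM} bN bM BM⊆BN =
    max-card⇒base (cobase∪indep∈𝓤 bN (proj₁ bM)) λ Y uY →
      ≤-trans (𝓤-size-bound bN bM uY) (≤-reflexive (sym (∣p∪q∣≡∣p∣+∣q∣ (∁ BN) BM disjoint)))
    where
    disjoint : ∀ {x} → x ∈ ∁ BN → x ∉ BM
    disjoint x∈∁BN x∈BM = x∈∁p⇒x∉p x∈∁BN (BM⊆BN x∈BM)

  𝓤-normal-form : ∀ {X} → 𝓤 X →
    ∃[ B ] ∃[ T ] (IsBase 𝓝 B × 𝓜 T × T ⊆ B × X ⊆ ∁ B ∪ T)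
  𝓤-normal-form (A , T , (B , bB , A⊆∁B) , lT , refl) =
    B , T ∩ B , bB , IsMatroid.hereditary mM lT (p∩q⊆p T B) , p∩q⊆q T B , cover
    where
    cover : A ∪ T ⊆ ∁ B ∪ (T ∩ B)
    cover {z} z∈A∪T with x∈p∪q⁻ A T z∈A∪T | z ∈? B
    ... | inj₁ z∈A | _       = p⊆p∪q (T ∩ B) (A⊆∁B z∈A)
    ... | inj₂ z∈T | yes z∈B = q⊆p∪q (∁ B) (T ∩ B) (x∈p∩q⁺ (z∈T , z∈B))
    ... | inj₂ z∈T | no z∉B  = p⊆p∪q (T ∩ B) (x∉p⇒x∈∁p z∉B)

  -- Given T ∪ {x} ∈ 𝓛(M) ⊆ 𝓛(N), extend it to a base B″ of N inside
  -- T ∪ {x} ∪ B.  Maximality of ∁B ∪ T against ∁B″ ∪ T ∪ {x} ∈ 𝓤 gives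
  -- B ⊆ B″, so B″ = B, and then x ∈ T.
  cobase∪indep-isBase⇒isBase : (∀ S → 𝓜 S → 𝓝 S) → ∀ {B T} →
    IsBase 𝓝 B → 𝓜 T → T ⊆ B → IsBase 𝓤 (∁ B ∪ T) → IsBase 𝓜 T
  cobase∪indep-isBase⇒isBase M⊆N {B} {T} bB lT T⊆B (_ , maxX) =
    base-by-single-extensions (IsMatroid.hereditary mM) lT absorb
    where
    absorb : ∀ x → 𝓜 (T ∪ ⁅ x ⁆) → x ∈ T
    absorb x lI with extend-to-base bB (M⊆N (T ∪ ⁅ x ⁆) lI)
    ... | B″ , bB″ , I⊆B″ , B″⊆I∪B =
      [ (λ x∈∁B → contradiction (B″⊆B (I⊆B″ x∈I)) (x∈∁p⇒x∉p x∈∁B)) , id ]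
        (x∈p∪q⁻ (∁ B) T (Z⊆X (q⊆p∪q (∁ B″) I x∈I)))
      where
      I = T ∪ ⁅ x ⁆
      x∈I : x ∈ I
      x∈I = q⊆p∪q T ⁅ x ⁆ (x∈⁅x⁆ x)
      X⊆Z : ∁ B ∪ T ⊆ ∁ B″ ∪ I
      X⊆Z {w} w∈X with x∈p∪q⁻ (∁ B) T w∈X | w ∈? B″
      ... | inj₂ w∈T  | _        = q⊆p∪q (∁ B″) I (p⊆p∪q ⁅ x ⁆ w∈T)
      ... | inj₁ _    | no w∉B″  = p⊆p∪q I (x∉p⇒x∈∁p w∉B″)
      ... | inj₁ w∈∁B | yes w∈B″ =
        [ q⊆p∪q (∁ B″) I , (λ w∈B → contradiction w∈B (x∈∁p⇒x∉p w∈∁B)) ]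
          (x∈p∪q⁻ I B (B″⊆I∪B w∈B″))
      Z⊆X : ∁ B″ ∪ I ⊆ ∁ B ∪ T
      Z⊆X = maxX (∁ B″ ∪ I) (cobase∪indep∈𝓤 bB″ lI) X⊆Z
      B⊆B″ : B ⊆ B″
      B⊆B″ w∈B = x∉∁p⇒x∈p λ w∈∁B″ →
        [ (λ w∈∁B → x∈∁p⇒x∉p w∈∁B w∈B) , (λ w∈T → x∈∁p⇒x∉p w∈∁B″ (I⊆B″ (p⊆p∪q ⁅ x ⁆ w∈T))) ]
          (x∈p∪q⁻ (∁ B) T (Z⊆X (p⊆p∪q I w∈∁B″)))
      B″⊆B : B″ ⊆ B
      B″⊆B = proj₂ bB B″ (proj₁ bB″) B⊆B″

theorem3p4p2 : (n : ℕ) (𝓝 𝓜 : SetSystem n) → IsMatroid 𝓝 → IsMatroid 𝓜 →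
    (∀ S → 𝓜 S → 𝓝 S) →
    ∀ (S : Subset n) → minus 𝓝 𝓜 S ⇔ dual (union (dual 𝓝) 𝓜) S
theorem3p4p2 n 𝓝 𝓜 mN mM M⊆N S = mk⇔ to from
  where
  open DualUnion mN mM

  -- S ⊆ B_N ─ B_M is the complement of the base ∁B_N ∪ B_M of 𝓤.
  to : minus 𝓝 𝓜 S → dual 𝓤 S
  to (BN , BM , bN , bM , BM⊆BN , S⊆BN─BM) =
    ∁ BN ∪ BM , cobase∪base-isBase bN bM BM⊆BN ,
    subst (S ⊆_) (sym (∁[∁p∪q]≡p─q BN BM)) S⊆BN─BM

  -- A base X of 𝓤 equals a basic member ∁B ∪ T with T ⊆ B, and T is a base of M.
  from : dual 𝓤 S → minus 𝓝 𝓜 S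
  from (X , bX , S⊆∁X) with 𝓤-normal-form (proj₁ bX)
  ... | B , T , bB , lT , T⊆B , X⊆∁B∪T =
    B , T , bB , cobase∪indep-isBase⇒isBase M⊆N bB lT T⊆B bB∪T , T⊆B , S⊆B─T
    where
    bB∪T : IsBase 𝓤 (∁ B ∪ T)
    bB∪T = base⊆member⇒base bX (cobase∪indep∈𝓤 bB lT) X⊆∁B∪T
    S⊆B─T : S ⊆ B ─ T
    S⊆B─T s∈S = subst (_ ∈_) (∁[∁p∪q]≡p─q B T)
      (p⊆q⇒∁p⊇∁q (proj₂ bX (∁ B ∪ T) (proj₁ bB∪T) X⊆∁B∪T) (S⊆∁X s∈S))
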